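{- Let $n\geq 1$. For a binary tree $B$ with $n$ nodes labeled $1,\dots,n$ in in-order (symmetric order), let $r_B(i)$ denote the number of nodes in the right subtree of node $i$ and $l_B(i)$ the number of nodes in the left subtree of node $i$. For a Tamari interval $[S,T]$ of size $n$ define $$\psi([S,T])=\bigl(r_S(1)-l_T(2),\ r_S(2)-l_T(3),\ \dots,\ r_S(n-1)-l_T(n)\bigr)\in\mathbb{Z}^{n-1}.$$ Then $\psi$ is an isomorphism of posets from $(\mathcal{TI}_n,\leq_{\mathrm{ti}})$ onto $(\mathcal{CC}_n,\leq_{\mathrm{cc}})$.
   Context: Binary trees and Tamari order: the Tamari order $\leq_{\mathrm{t}}$ on binary trees with $n$ nodes is the reflexive–transitive closure of right rotation, which replaces a subtree of the form $((A,x,B),y,C)$ (node $y$ with left child $x$, where $x$ has subtrees $A,B$, and $y$ has right subtree $C$) by $(A,x,(B,y,C))$. A Tamari interval of size $n$ is a pair $[S,T]$ of binary trees with $n$ nodes such that $S\leq_{\mathrm{t}}T$; $\mathcal{TI}_n$ denotes their set, ordered by $[S,T]\leq_{\mathrm{ti}}[S',T']$ iff $S\leq_{\mathrm{t}}S'$ and $T\leq_{\mathrm{t}}T'$. (The map $\psi$ above is the composite of the Châtel–Pons bijection from Tamari intervals to interval-posets, which records $j\lhd i$ ($i<j$) when $j$ is in the right subtree of $i$ in $S$ and $i\lhd j$ when $i$ is in the left subtree of $j$ in $T$, with the maps of this paper.) Tamari diagrams: a Tamari diagram of size $n$ is a word $u=u_1\cdots u_n$ of integers with $0\le u_i\le n-i$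 for all $i\in[n]$ and $u_{i+j}\le u_i-j$ for all $i\in[n]$ and $0\le j\le u_i$. A dual Tamari diagram of size $n$ is a word $v=v_1\cdots v_n$ of integers with $0\le v_i\le i-1$ for all $i\in[n]$ and $v_{i-j}\le v_i-j$ for all $i\in[n]$ and $0\le j\le v_i$. A Tamari diagram $u$ and a dual Tamari diagram $v$ of size $n$ are compatible if for all $1\le i<j\le n$ with $j-i\le u_i$ one has $v_j<j-i$; such a pair $(u,v)$ is a Tamari interval diagram, and $\mathcal{TID}_n$ is their set. Cubic coordinates: an $(n-1)$-tuple $c=(c_1,\dots,c_{n-1})$ of integers is a cubic coordinate (of size $n$) if the pair $(u,v)$ given by $u_i=\max(c_i,0)$ for $i\in[n-1]$, $u_n=0$, $v_1=0$, $v_i=|\min(c_{i-1},0)|$ for $2\le i\le n$, is a Tamari interval diagram. $\mathcal{CC}_n$ is the set of cubic coordinates of size $n$, ordered componentwise: $c\leq_{\mathrm{cc}}c'$ iff $c_i\le c'_i$ for all $i\in[n-1]$. -}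

module Defs where

open import Data.Nat using (ℕ; zero; suc; _+_; _∸_; _≤_; _<_)
open import Data.Integer as ℤ using (ℤ; +_; _-_; ∣_∣; _⊔_; _⊓_)
open import Data.List using (List; []; _∷_; _++_; [_]; length; map; applyUpTo)
open import Data.List.Relation.Binary.Pointwise using (Pointwise)
open import Data.Product using (_×_; _,_; proj₁; proj₂)
open import Relation.Binary.Construct.Closure.ReflexiveTransitive using (Star)
open import Relation.Binary.PropositionalEquality using (_≡_)

-- Binary trees (nodes are the internal `node`s; `leaf` is the empty tree)

data BT : Set where
  leaf : BT
  node : BT → BT → BT

size : BT → ℕ
size leaf       = 0
size (node a b) = suc (size a + size b)

data RightRot : BT → BT → Set where
  rot   : ∀ A B C → RightRot (node (node A B) C) (node A (node B C))
  left  : ∀ {a a'} b → RightRot a a' → RightRot (node a b) (node a' b)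
  right : ∀ a {b b'} → RightRot b b' → RightRot (node a b) (node a b')

_≤t_ : BT → BT → Set
_≤t_ = Star RightRot

lrList : BT → List (ℕ × ℕ)
lrList leaf       = []
lrList (node a b) = lrList a ++ [ (size a , size b) ] ++ lrList b

-- 1-indexed lookup with default 0 (only used in range)
at : {A : Set} → A → List A → ℕ → A
at d []       _             = d
at d (x ∷ xs) zero          = d
at d (x ∷ xs) (suc zero)    = x
at d (x ∷ xs) (suc (suc i)) = at d xs (suc i)

rB : BT → ℕ → ℕ
rB B i = proj₂ (at (0 , 0) (lrList B) i)

lB : BT → ℕ → ℕ
lB B i = proj₁ (at (0 , 0) (lrList B) i)

IsTI : ℕ → BT → BT → Set
IsTI n S T = size S ≡ n × size T ≡ n × S ≤t T

_≤ti_ : (BT × BT) → (BT × BT) → Set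
(S , T) ≤ti (S' , T') = S ≤t S' × T ≤t T'

ψ : ℕ → BT → BT → List ℤ
ψ n S T = applyUpTo (λ k → + rB S (suc k) - + lB T (suc (suc k))) (n ∸ 1)

-- Tamari (interval) diagrams; words u = u_1 ... u_n, letter u_i = at 0 u i

IsTamariDiagram : ℕ → List ℕ → Set
IsTamariDiagram n u =
  length u ≡ n ×
  (∀ i → 1 ≤ i → i ≤ n → at 0 u i ≤ n ∸ i) ×
  (∀ i j → 1 ≤ i → i ≤ n → j ≤ at 0 u i → at 0 u (i + j) + j ≤ at 0 u i)

IsDualTamariDiagram : ℕ → List ℕ → Set
IsDualTamariDiagram n v =
  length v ≡ n ×
  (∀ i → 1 ≤ i → i ≤ n → at 0 v i ≤ i ∸ 1) ×
  (∀ i j → 1 ≤ i → i ≤ n → j ≤ at 0 v i → at 0 v (i ∸ j) + j ≤ at 0 v i)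

Compatible : ℕ → List ℕ → List ℕ → Set
Compatible n u v =
  ∀ i j → 1 ≤ i → i < j → j ≤ n → j ∸ i ≤ at 0 u i → at 0 v j < j ∸ i

IsTID : ℕ → List ℕ → List ℕ → Set
IsTID n u v = IsTamariDiagram n u × IsDualTamariDiagram n v × Compatible n u v

uOf : List ℤ → List ℕ
uOf c = map (λ x → ∣ x ⊔ + 0 ∣) c ++ [ 0 ]

vOf : List ℤ → List ℕ
vOf c = 0 ∷ map (λ x → ∣ x ⊓ + 0 ∣) c

IsCC : ℕ → List ℤ → Set
IsCC n c = length c ≡ n ∸ 1 × IsTID n (uOf c) (vOf c)

_≤cc_ : List ℤ → List ℤ → Set
_≤cc_ = Pointwise ℤ._≤_

module Submission where

-- A binary tree B with nodes labelled 1..n in in-order carries two words: the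
-- right-subtree sizes r_B and the left-subtree sizes l_B.
-- The theorem then splits into four parts: ψ lands in cubic coordinates (the
-- diagram facts), is injective (r-words determine trees), surjective (build
-- S, T from the two words; compatibility gives S ≤t T) and an order
-- isomorphism (monotonicity of r, l and the Huang–Tamari criterion).

open import Defs
open import Data.Nat using (ℕ; zero; suc; _+_; _∸_; _≤_; _<_; _≤?_; _≟_; z≤n; s≤s; s≤s⁻¹)
open import Data.Nat.Properties
import Data.Integer as Int
open Int using (ℤ)
import Data.Integer.Properties as IntP
open import Data.List using (List; []; _∷_; _++_; length; map; applyUpTo)
open import Data.List.Properties using (length-++; length-map; length-applyUpTo)
open import Data.List.Relation.Binary.Pointwise using (Pointwise; []; _∷_)
open import Data.Product using (_×_; _,_; proj₁; proj₂; Σ)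
open import Data.Sum using (_⊎_; inj₁; inj₂)
open import Data.Empty using (⊥-elim)
open import Function.Bundles using (_⇔_; mk⇔)
open import Relation.Binary.PropositionalEquality
open import Relation.Binary.Construct.Closure.ReflexiveTransitive using (ε; _◅_; _◅◅_)
open import Relation.Binary.Definitions using (tri<; tri≈; tri>)
open import Relation.Nullary using (¬_; yes; no)
open import Relation.Nullary.Negation using (contradiction)

at-zero : {A : Set} (d : A) (xs : List A) → at d xs 0 ≡ d
at-zero d []       = refl
at-zero d (x ∷ xs) = refl

at-beyond : {A : Set} (d : A) (xs : List A) (i : ℕ) → length xs < i → at d xs i ≡ d
at-beyond d []       i             _       = refl
at-beyond d (x ∷ xs) (suc (suc i)) (s≤s p) = at-beyond d xs (suc i) p

at-++ˡ : {A : Set} (d : A) (xs ys : List A) (i : ℕ) → i ≤ length xs →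
         at d (xs ++ ys) i ≡ at d xs i
at-++ˡ d []       ys zero          _       = at-zero d ys
at-++ˡ d (x ∷ xs) ys zero          _       = refl
at-++ˡ d (x ∷ xs) ys (suc zero)    _       = refl
at-++ˡ d (x ∷ xs) ys (suc (suc i)) (s≤s p) = at-++ˡ d xs ys (suc i) p

at-suc : {A : Set} (d x : A) (xs : List A) (i : ℕ) → 1 ≤ i → at d (x ∷ xs) (suc i) ≡ at d xs i
at-suc d x xs (suc i) _ = refl

at-++ʳ : {A : Set} (d : A) (xs ys : List A) (i : ℕ) → 1 ≤ i →
         at d (xs ++ ys) (length xs + i) ≡ at d ys i
at-++ʳ d []       ys i _ = refl
at-++ʳ d (x ∷ xs) ys i p =
  trans (at-suc d x (xs ++ ys) (length xs + i) (≤-trans p (m≤n+m i (length xs))))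
        (at-++ʳ d xs ys i p)

length-lrList : (B : BT) → length (lrList B) ≡ size B
length-lrList leaf       = refl
length-lrList (node a b) = begin
  length (lrList a ++ (size a , size b) ∷ lrList b) ≡⟨ length-++ (lrList a) ⟩
  length (lrList a) + suc (length (lrList b))        ≡⟨ cong₂ (λ x y → x + suc y) (length-lrList a) (length-lrList b) ⟩
  size a + suc (size b)                              ≡⟨ +-suc (size a) (size b) ⟩
  suc (size a + size b)                              ∎
  where open ≡-Reasoning

data Position (k : ℕ) : ℕ → Set where
  inLeft  : ∀ i → i ≤ k → Position k i
  atRoot  : Position k (suc k)
  inRight : ∀ m → Position k (suc k + suc m)

position : ∀ k i → Position k i
position k       zero          = inLeft 0 z≤n
position zero    (suc zero)    = atRoot
position zero    (suc (suc m)) = inRight m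
position (suc k) (suc i) with position k i
... | inLeft i p = inLeft (suc i) (s≤s p)
... | atRoot     = atRoot
... | inRight m  = inRight m

-- The pair (l_B(i), r_B(i)); it is (0, 0) outside the labels 1 .. size B.
entry : BT → ℕ → ℕ × ℕ
entry B i = at (0 , 0) (lrList B) i

entry-left : ∀ a b i → i ≤ size a → entry (node a b) i ≡ entry a i
entry-left a b i p = at-++ˡ (0 , 0) (lrList a) _ i (subst (i ≤_) (sym (length-lrList a)) p)

entry-right⁺ : ∀ a b i → 1 ≤ i →
               entry (node a b) (size a + i) ≡ at (0 , 0) ((size a , size b) ∷ lrList b) i
entry-right⁺ a b i p =
  subst (λ k → at (0 , 0) (lrList (node a b)) (k + i) ≡ at (0 , 0) ((size a , size b) ∷ lrList b) i)
        (length-lrList a) (at-++ʳ (0 , 0) (lrList a) _ i p)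

entry-root : ∀ a b i → i ≡ suc (size a) → entry (node a b) i ≡ (size a , size b)
entry-root a b i refl = trans (cong (entry (node a b)) (+-comm 1 (size a))) (entry-right⁺ a b 1 (s≤s z≤n))

entry-right : ∀ a b i m → i ≡ suc (size a) + suc m → entry (node a b) i ≡ entry b (suc m)
entry-right a b i m refl =
  trans (cong (entry (node a b)) (sym (+-suc (size a) (suc m)))) (entry-right⁺ a b (suc (suc m)) (s≤s z≤n))

entry-beyond : ∀ B i → size B < i → entry B i ≡ (0 , 0)
entry-beyond B i p = at-beyond (0 , 0) (lrList B) i (subst (_< i) (sym (length-lrList B)) p)

-- The recursive description of r_B and l_B along `node a b`; the label is
-- given up to an equation so that callers may present it in any form.

r-left : ∀ a b i → i ≤ size a → rB (node a b) i ≡ rB a i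
r-left a b i p = cong proj₂ (entry-left a b i p)

l-left : ∀ a b i → i ≤ size a → lB (node a b) i ≡ lB a i
l-left a b i p = cong proj₁ (entry-left a b i p)

r-root : ∀ a b i → i ≡ suc (size a) → rB (node a b) i ≡ size b
r-root a b i p = cong proj₂ (entry-root a b i p)

l-root : ∀ a b i → i ≡ suc (size a) → lB (node a b) i ≡ size a
l-root a b i p = cong proj₁ (entry-root a b i p)

r-right : ∀ a b i m → i ≡ suc (size a) + suc m → rB (node a b) i ≡ rB b (suc m)
r-right a b i m p = cong proj₂ (entry-right a b i m p)

l-right : ∀ a b i m → i ≡ suc (size a) + suc m → lB (node a b) i ≡ lB b (suc m)
l-right a b i m p = cong proj₁ (entry-right a b i m p)

r-beyond : ∀ B i → size B < i → rB B i ≡ 0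
r-beyond B i p = cong proj₂ (entry-beyond B i p)

l-beyond : ∀ B i → size B < i → lB B i ≡ 0
l-beyond B i p = cong proj₁ (entry-beyond B i p)

r-zero : ∀ B → rB B 0 ≡ 0
r-zero B = cong proj₂ (at-zero (0 , 0) (lrList B))

l-zero : ∀ B → lB B 0 ≡ 0
l-zero B = cong proj₁ (at-zero (0 , 0) (lrList B))

-- The words r_B and l_B are a Tamari diagram and a dual Tamari diagram

+-within : ∀ {i j n} → i ≤ n → j ≤ n ∸ i → i + j ≤ n
+-within {i} {j} {n} i≤n j≤n∸i = subst (_≤ n) (+-comm j i) (m≤o∸n⇒m+n≤o j i≤n j≤n∸i)

-- The right subtree of label i consists of labels i+1, …: r_B(i) ≤ n - i.
r-bounded : ∀ B i → rB B i ≤ size B ∸ i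
r-bounded leaf i = z≤n
r-bounded (node a b) i with position (size a) i
... | inLeft i p = begin
  rB (node a b) i      ≡⟨ r-left a b i p ⟩
  rB a i               ≤⟨ r-bounded a i ⟩
  size a ∸ i           ≤⟨ ∸-monoˡ-≤ i (m≤n⇒m≤1+n (m≤m+n (size a) (size b))) ⟩
  size (node a b) ∸ i  ∎
  where open ≤-Reasoning
... | atRoot = ≤-reflexive (trans (r-root a b _ refl) (sym (m+n∸m≡n (size a) (size b))))
... | inRight m = begin
  rB (node a b) _                          ≡⟨ r-right a b _ m refl ⟩
  rB b (suc m)                             ≤⟨ r-bounded b (suc m) ⟩
  size b ∸ suc m                           ≡⟨ [m+n]∸[m+o]≡n∸o (size a) (size b) (suc m) ⟨
  size (node a b) ∸ (suc (size a) + suc m) ∎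
  where open ≤-Reasoning

r-from-last : ∀ B i → size B ≤ i → rB B i ≡ 0
r-from-last B i B≤i = n≤0⇒n≡0 (subst (rB B i ≤_) (m≤n⇒m∸n≡0 B≤i) (r-bounded B i))

-- The right subtree of i contains the right subtree of every label i + j it
-- contains: r_B(i + j) + j ≤ r_B(i) for j ≤ r_B(i).
r-nested : ∀ B i j → j ≤ rB B i → rB B (i + j) + j ≤ rB B i
r-nested leaf i zero _ = z≤n
r-nested (node a b) i j q with position (size a) i
... | inLeft i p =
  let q' = subst (j ≤_) (r-left a b i p) q
      i+j≤ = +-within p (≤-trans q' (r-bounded a i))
  in subst₂ (λ u v → u + j ≤ v) (sym (r-left a b (i + j) i+j≤)) (sym (r-left a b i p))
            (r-nested a i j q')
r-nested (node a b) _ zero q | atRoot =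
  ≤-reflexive (trans (+-identityʳ _) (cong (rB (node a b)) (+-identityʳ _)))
r-nested (node a b) _ (suc j) q | atRoot =
  subst₂ (λ u v → u + suc j ≤ v) (sym (r-right a b _ j refl)) (sym (r-root a b _ refl))
         (m≤o∸n⇒m+n≤o _ (subst (suc j ≤_) (r-root a b _ refl) q) (r-bounded b (suc j)))
... | inRight m =
  subst₂ (λ u v → u + j ≤ v) (sym (r-right a b _ (m + j) (+-assoc (suc (size a)) (suc m) j)))
         (sym (r-right a b _ m refl)) (r-nested b (suc m) j (subst (j ≤_) (r-right a b _ m refl) q))

-- The left subtree of label i consists of labels …, i-1: l_B(i) ≤ i - 1.
l-bounded : ∀ B i → lB B i ≤ i ∸ 1
l-bounded leaf i = z≤n
l-bounded (node a b) i with position (size a) i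
... | inLeft i p = subst (_≤ i ∸ 1) (sym (l-left a b i p)) (l-bounded a i)
... | atRoot     = ≤-reflexive (l-root a b _ refl)
... | inRight m  = begin
  lB (node a b) _  ≡⟨ l-right a b _ m refl ⟩
  lB b (suc m)     ≤⟨ l-bounded b (suc m) ⟩
  m                ≤⟨ n≤1+n m ⟩
  suc m            ≤⟨ m≤n+m (suc m) (size a) ⟩
  size a + suc m   ∎
  where open ≤-Reasoning

l-nested : ∀ B i j → j ≤ lB B i → lB B (i ∸ j) + j ≤ lB B i
l-nested leaf i zero _ = z≤n
l-nested (node a b) i j q with position (size a) i
... | inLeft i p =
  subst₂ (λ u v → u + j ≤ v) (sym (l-left a b (i ∸ j) (≤-trans (m∸n≤m i j) p))) (sym (l-left a b i p))
         (l-nested a i j (subst (j ≤_) (l-left a b i p) q))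
l-nested (node a b) _ zero q | atRoot = ≤-reflexive (+-identityʳ _)
l-nested (node a b) _ (suc j) q | atRoot =
  subst₂ (λ u v → u + suc j ≤ v) (sym (l-left a b _ (m∸n≤m (size a) j))) (sym (l-root a b _ refl))
         (m≤o∸n⇒m+n≤o _ (subst (suc j ≤_) (l-root a b _ refl) q) left-bound)
  where
  left-bound : lB a (size a ∸ j) ≤ size a ∸ suc j
  left-bound = ≤-trans (l-bounded a (size a ∸ j))
                       (≤-reflexive (trans (∸-+-assoc (size a) j 1) (cong (size a ∸_) (+-comm j 1))))
... | inRight m = subst₂ (λ u v → u + j ≤ v) (sym l-shifted) (sym (l-right a b _ m refl)) (l-nested b (suc m) j q')
  where
  q' : j ≤ lB b (suc m)
  q' = subst (j ≤_) (l-right a b _ m refl) q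
  j≤m : j ≤ m
  j≤m = ≤-trans q' (l-bounded b (suc m))
  l-shifted : lB (node a b) (suc (size a) + suc m ∸ j) ≡ lB b (suc m ∸ j)
  l-shifted = trans (l-right a b _ (m ∸ j)
                       (trans (+-∸-assoc (suc (size a)) (m≤n⇒m≤1+n j≤m)) (cong (suc (size a) +_) (+-∸-assoc 1 j≤m))))
                    (cong (lB b) (sym (+-∸-assoc 1 j≤m)))

root<right : ∀ k m → suc k < suc k + suc m
root<right k m = m<m+n (suc k) (s≤s z≤n)

-- If label j lies in the right subtree of i, the left subtree of j lies
-- strictly between i and j: (r_B, l_B) is a compatible pair.
r-l-compatible : ∀ B i j → 1 ≤ i → i < j → j ∸ i ≤ rB B i → lB B j < j ∸ i
r-l-compatible leaf i j _ i<j q = contradiction (≤-trans (m<n⇒0<n∸m i<j) q) (λ ())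
r-l-compatible (node a b) i j 1≤i i<j q with position (size a) i
... | inLeft i p =
  let q' = subst (j ∸ i ≤_) (r-left a b i p) q
      j≤a = subst (_≤ size a) (m+[n∸m]≡n (<⇒≤ i<j)) (+-within p (≤-trans q' (r-bounded a i)))
  in subst (_< j ∸ i) (sym (l-left a b j j≤a)) (r-l-compatible a i j 1≤i i<j q')
... | atRoot with position (size a) j
...   | inLeft j p = contradiction (≤-trans i<j p) (λ h → 1+n≰n (≤-trans h (n≤1+n _)))
...   | atRoot     = contradiction i<j (<-irrefl refl)
...   | inRight m  = subst₂ _<_ (sym (l-right a b _ m refl)) (sym (m+n∸m≡n (suc (size a)) (suc m)))
                             (s≤s (l-bounded b (suc m)))
r-l-compatible (node a b) _ j 1≤i i<j q | inRight m with position (size a) j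
...   | inLeft j p = contradiction (≤-trans (<-trans (root<right (size a) m) i<j) p) (λ h → 1+n≰n (≤-trans h (n≤1+n _)))
...   | atRoot     = contradiction (<-trans (root<right (size a) m) i<j) (<-irrefl refl)
...   | inRight m' =
  let gap = [m+n]∸[m+o]≡n∸o (suc (size a)) (suc m') (suc m)
      q'  = subst₂ _≤_ gap (r-right a b _ m refl) q
  in subst₂ _<_ (sym (l-right a b _ m' refl)) (sym gap)
            (r-l-compatible b (suc m) (suc m') (s≤s z≤n) (+-cancelˡ-< (suc (size a)) (suc m) (suc m') i<j) q')

-- The label i + r_B(i) + 1 just after the right subtree of i (if it exists) is the
-- ancestor whose left subtree ends at i + r_B(i); that subtree contains i and
-- its right subtree, hence has more than r_B(i) nodes.
l-after-right-subtree : ∀ B i → 1 ≤ i → i + rB B i < size B → rB B i < lB B (suc (i + rB B i))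
l-after-right-subtree (node a b) i 1≤i h with position (size a) i
... | inLeft i p =
  subst (λ r → r < lB (node a b) (suc (i + r))) (sym (r-left a b i p))
        (within-left (+-within p (r-bounded a i)))
  where
  within-left : i + rB a i ≤ size a → rB a i < lB (node a b) (suc (i + rB a i))
  within-left le with m≤n⇒m<n∨m≡n le
  ... | inj₁ lt = subst (rB a i <_) (sym (l-left a b _ lt)) (l-after-right-subtree a i 1≤i lt)
  ... | inj₂ eq = subst (rB a i <_) (sym (l-root a b _ (cong suc eq)))
                        (subst (rB a i <_) eq (+-monoˡ-≤ (rB a i) 1≤i))
... | atRoot = contradiction (subst (_< size (node a b)) (cong (suc (size a) +_) (r-root a b _ refl)) h)
                             (<-irrefl refl)
... | inRight m =
  subst (λ r → r < lB (node a b) (suc (suc (size a) + suc m + r))) (sym (r-right a b _ m refl))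
        (subst (r <_) (sym (l-right a b _ (suc m + r) shift))
               (l-after-right-subtree b (suc m) (s≤s z≤n) in-b))
  where
  A = suc (size a)
  r = rB b (suc m)
  in-b : suc m + r < size b
  in-b = +-cancelˡ-< A (suc m + r) (size b)
           (subst (_< A + size b) (+-assoc A (suc m) r)
                  (subst (λ z → A + suc m + z < size (node a b)) (r-right a b _ m refl) h))
  shift : suc (A + suc m + r) ≡ A + suc (suc m + r)
  shift = trans (cong suc (+-assoc A (suc m) r)) (sym (+-suc A (suc m + r)))

-- Right rotations: r grows and l shrinks

rotation-size : ∀ A B C → size (node (node A B) C) ≡ size (node A (node B C))
rotation-size A B C =
  cong suc (trans (cong suc (+-assoc (size A) (size B) (size C))) (sym (+-suc (size A) (size B + size C))))

rightRot-size : ∀ {S S'} → RightRot S S' → size S ≡ size S'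
rightRot-size (rot A B C) = rotation-size A B C
rightRot-size (left b r)  = cong (λ z → suc (z + size b)) (rightRot-size r)
rightRot-size (right a r) = cong (λ z → suc (size a + z)) (rightRot-size r)

inner-left : ∀ A B i → i ≤ size A → i ≤ size (node A B)
inner-left A B i p = m≤n⇒m≤1+n (≤-trans p (m≤m+n (size A) (size B)))

-- Rotating ((A,x,B),y,C) into (A,x,(B,y,C)) keeps the labels; x is label
-- suc (size A), and the rotation changes no right subtree size except that of x ...
rotation-r-stable : ∀ A B C i → i ≢ suc (size A) →
                    rB (node A (node B C)) i ≡ rB (node (node A B) C) i
rotation-r-stable A B C i ne with position (size A) i
... | inLeft i p = trans (r-left A (node B C) i p)
                         (sym (trans (r-left (node A B) C i (inner-left A B i p)) (r-left A B i p)))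
... | atRoot = contradiction refl ne
... | inRight m with position (size B) (suc m)
...   | inLeft _ p = trans (r-right A (node B C) _ m refl) (trans (r-left B C _ p)
          (sym (trans (r-left (node A B) C _ (s≤s (+-monoʳ-≤ (size A) p))) (r-right A B _ m refl))))
...   | atRoot = trans (r-right A (node B C) _ _ refl) (trans (r-root B C _ refl)
          (sym (r-root (node A B) C _ (cong suc (+-suc (size A) (size B))))))
...   | inRight m' = trans (r-right A (node B C) _ _ refl) (trans (r-right B C _ m' refl)
          (sym (r-right (node A B) C _ m' (cong suc (trans (+-suc (size A) _)
                  (cong suc (sym (+-assoc (size A) (size B) (suc m')))))))))

-- ... and beside y = suc (size A) + suc (size B) no left subtree size.
rotation-l-stable : ∀ A B C i → i ≢ suc (size A) + suc (size B) →
                    lB (node A (node B C)) i ≡ lB (node (node A B) C) i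
rotation-l-stable A B C i ne with position (size A) i
... | inLeft i p = trans (l-left A (node B C) i p)
                         (sym (trans (l-left (node A B) C i (inner-left A B i p)) (l-left A B i p)))
... | atRoot = trans (l-root A (node B C) _ refl)
                     (sym (trans (l-left (node A B) C _ (s≤s (m≤m+n (size A) (size B)))) (l-root A B _ refl)))
... | inRight m with position (size B) (suc m)
...   | inLeft _ p = trans (l-right A (node B C) _ m refl) (trans (l-left B C _ p)
          (sym (trans (l-left (node A B) C _ (s≤s (+-monoʳ-≤ (size A) p))) (l-right A B _ m refl))))
...   | atRoot = contradiction refl ne
...   | inRight m' = trans (l-right A (node B C) _ _ refl) (trans (l-right B C _ m' refl)
          (sym (l-right (node A B) C _ m' (cong suc (trans (+-suc (size A) _)
                  (cong suc (sym (+-assoc (size A) (size B) (suc m')))))))))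

-- At x the right subtree grows from B to (B,y,C).
rotation-r-grows : ∀ A B C i → rB (node (node A B) C) i ≤ rB (node A (node B C)) i
rotation-r-grows A B C i with i ≟ suc (size A)
... | no ne = ≤-reflexive (sym (rotation-r-stable A B C i ne))
... | yes refl =
  subst₂ _≤_ (sym (trans (r-left (node A B) C _ (s≤s (m≤m+n (size A) (size B)))) (r-root A B _ refl)))
             (sym (r-root A (node B C) _ refl)) (m≤n⇒m≤1+n (m≤m+n (size B) (size C)))

-- At y the left subtree shrinks from (A,x,B) to B.
rotation-l-shrinks : ∀ A B C i → lB (node A (node B C)) i ≤ lB (node (node A B) C) i
rotation-l-shrinks A B C i with i ≟ suc (size A) + suc (size B)
... | no ne = ≤-reflexive (rotation-l-stable A B C i ne)
... | yes refl =
  subst₂ _≤_ (sym (trans (l-right A (node B C) _ (size B) refl) (l-root B C _ refl)))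
             (sym (l-root (node A B) C _ (cong suc (+-suc (size A) (size B)))))
             (m≤n⇒m≤1+n (m≤n+m (size B) (size A)))

rightRot-r-mono : ∀ {S S'} → RightRot S S' → ∀ i → rB S i ≤ rB S' i
rightRot-r-mono (rot A B C) i = rotation-r-grows A B C i
rightRot-r-mono (left {a} {a'} b r) i with position (size a) i
... | inLeft i p = subst₂ _≤_ (sym (r-left a b i p)) (sym (r-left a' b i (subst (i ≤_) (rightRot-size r) p)))
                          (rightRot-r-mono r i)
... | atRoot     = ≤-reflexive (trans (r-root a b _ refl) (sym (r-root a' b _ (cong suc (rightRot-size r)))))
... | inRight m  = ≤-reflexive (trans (r-right a b _ m refl)
                                      (sym (r-right a' b _ m (cong (λ z → suc z + suc m) (rightRot-size r)))))
rightRot-r-mono (right a {b} {b'} r) i with position (size a) i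
... | inLeft i p = ≤-reflexive (trans (r-left a b i p) (sym (r-left a b' i p)))
... | atRoot     = subst₂ _≤_ (sym (r-root a b _ refl)) (sym (r-root a b' _ refl)) (≤-reflexive (rightRot-size r))
... | inRight m  = subst₂ _≤_ (sym (r-right a b _ m refl)) (sym (r-right a b' _ m refl))
                          (rightRot-r-mono r (suc m))

rightRot-l-anti : ∀ {S S'} → RightRot S S' → ∀ i → lB S' i ≤ lB S i
rightRot-l-anti (rot A B C) i = rotation-l-shrinks A B C i
rightRot-l-anti (left {a} {a'} b r) i with position (size a) i
... | inLeft i p = subst₂ _≤_ (sym (l-left a' b i (subst (i ≤_) (rightRot-size r) p))) (sym (l-left a b i p))
                          (rightRot-l-anti r i)
... | atRoot     = ≤-reflexive (trans (l-root a' b _ (cong suc (rightRot-size r)))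
                                      (trans (sym (rightRot-size r)) (sym (l-root a b _ refl))))
... | inRight m  = ≤-reflexive (trans (l-right a' b _ m (cong (λ z → suc z + suc m) (rightRot-size r)))
                                      (sym (l-right a b _ m refl)))
rightRot-l-anti (right a {b} {b'} r) i with position (size a) i
... | inLeft i p = ≤-reflexive (trans (l-left a b' i p) (sym (l-left a b i p)))
... | atRoot     = ≤-reflexive (trans (l-root a b' _ refl) (sym (l-root a b _ refl)))
... | inRight m  = subst₂ _≤_ (sym (l-right a b' _ m refl)) (sym (l-right a b _ m refl))
                          (rightRot-l-anti r (suc m))

≤t-r-mono : ∀ {S S'} → S ≤t S' → ∀ i → rB S i ≤ rB S' i
≤t-r-mono ε        i = ≤-refl
≤t-r-mono (r ◅ rs) i = ≤-trans (rightRot-r-mono r i) (≤t-r-mono rs i)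

≤t-l-anti : ∀ {S S'} → S ≤t S' → ∀ i → lB S' i ≤ lB S i
≤t-l-anti ε        i = ≤-refl
≤t-l-anti (r ◅ rs) i = ≤-trans (≤t-l-anti rs i) (rightRot-l-anti r i)

-- A tree is determined by its size and its word r_B

right-subtree-within : ∀ B i → 0 < rB B i → i + rB B i ≤ size B
right-subtree-within B i p with i ≤? size B
... | yes q = +-within q (r-bounded B i)
... | no nq = contradiction (subst (0 <_) (r-beyond B i (≰⇒> nq)) p) (λ ())

-- With the same r-word, node a b and node a' b' have equally large left subtrees:
-- if |a| < |a'|, the root of node a b is a label of a' whose right subtree
-- (of size |b|) would have to fit inside a'.
left-size-not-smaller : ∀ a b a' b' → size (node a b) ≡ size (node a' b') →
  (∀ i → rB (node a b) i ≡ rB (node a' b') i) → ¬ size a < size a'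
left-size-not-smaller a b a' b' same-size same-r lt =
  1+n≰n (≤-trans (s≤s (m≤m+n (size a') (size b'))) (subst (_≤ size a') same-size too-big))
  where
  root = suc (size a)
  r-root-in-a' : size b ≡ rB a' root
  r-root-in-a' = trans (sym (r-root a b root refl)) (trans (same-r root) (r-left a' b' root lt))
  too-big : size (node a b) ≤ size a'
  too-big = subst (λ z → root + z ≤ size a') (sym r-root-in-a') (+-within lt (r-bounded a' root))

r-injective : ∀ S S' → size S ≡ size S' → (∀ i → rB S i ≡ rB S' i) → S ≡ S'
r-injective leaf leaf _ _ = refl
r-injective (node a b) (node a' b') same-size same-r with <-cmp (size a) (size a')
... | tri< lt _ _ = ⊥-elim (left-size-not-smaller a b a' b' same-size same-r lt)
... | tri> _ _ gt = ⊥-elim (left-size-not-smaller a' b' a b (sym same-size) (λ i → sym (same-r i)) gt)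
... | tri≈ _ ea _ = cong₂ node (r-injective a a' ea same-r-a) (r-injective b b' eb same-r-b)
  where
  eb : size b ≡ size b'
  eb = +-cancelˡ-≡ (size a) (size b) (size b')
         (trans (suc-injective same-size) (cong (_+ size b') (sym ea)))
  same-r-a : ∀ i → rB a i ≡ rB a' i
  same-r-a i with i ≤? size a
  ... | yes p = trans (sym (r-left a b i p)) (trans (same-r i) (r-left a' b' i (subst (i ≤_) ea p)))
  ... | no np = trans (r-beyond a i (≰⇒> np)) (sym (r-beyond a' i (subst (_< i) ea (≰⇒> np))))
  same-r-b : ∀ i → rB b i ≡ rB b' i
  same-r-b zero    = trans (r-zero b) (sym (r-zero b'))
  same-r-b (suc m) = trans (sym (r-right a b _ m refl))
                           (trans (same-r _) (r-right a' b' _ m (cong (λ z → suc z + suc m) ea)))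

-- The Huang–Tamari criterion: r_S ≤ r_T pointwise implies S ≤t T

-- The labels 1..k of B are closed under taking right subtrees.
PrefixClosed : BT → ℕ → Set
PrefixClosed B k = ∀ i → 1 ≤ i → i ≤ k → i + rB B i ≤ k

prefixClosed-left : ∀ a b k → k ≤ size a → PrefixClosed (node a b) k → PrefixClosed a k
prefixClosed-left a b k k≤a closed i 1≤i i≤k =
  subst (λ z → i + z ≤ k) (r-left a b i (≤-trans i≤k k≤a)) (closed i 1≤i i≤k)

prefixClosed-in-left : ∀ a b k → k < size (node a b) → PrefixClosed (node a b) k → k ≤ size a
prefixClosed-in-left a b k k<N closed with k ≤? size a
... | yes k≤a = k≤a
... | no k≰a = ⊥-elim (<⇒≱ k<N root-closed)
  where
  root-closed : size (node a b) ≤ k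
  root-closed = subst (_≤ k) (cong (suc (size a) +_) (r-root a b _ refl)) (closed (suc (size a)) (s≤s z≤n) (≰⇒> k≰a))

left* : ∀ {a a'} b → a ≤t a' → node a b ≤t node a' b
left* b ε        = ε
left* b (r ◅ rs) = left b r ◅ left* b rs

right* : ∀ a {b b'} → b ≤t b' → node a b ≤t node a b'
right* a ε        = ε
right* a (r ◅ rs) = right a r ◅ right* a rs

r-replace-left : ∀ a a' b → size a ≡ size a' → ∀ i → (i ≤ size a → rB a i ≡ rB a' i) →
                 rB (node a b) i ≡ rB (node a' b) i
r-replace-left a a' b e i same with position (size a) i
... | inLeft i p = trans (r-left a b i p) (trans (same p) (sym (r-left a' b i (subst (i ≤_) e p))))
... | atRoot     = trans (r-root a b _ refl) (sym (r-root a' b _ (cong suc e)))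
... | inRight m  = trans (r-right a b _ m refl) (sym (r-right a' b _ m (cong (λ z → suc z + suc m) e)))

-- If the right subtrees of the labels 1..k stay inside 1..k, right rotations
-- bring S to a tree node X Y with |X| = k; only r(k+1) changes on the way.
-- (Rotate at the root while the left subtree is too large.)
rotate-to-split : ∀ S k → k < size S → PrefixClosed S k →
  Σ BT λ X → Σ BT λ Y → S ≤t node X Y × size X ≡ k × size (node X Y) ≡ size S ×
    (∀ i → i ≢ suc k → rB (node X Y) i ≡ rB S i)
rotate-to-split (node a b) k k<S closed with m≤n⇒m<n∨m≡n (prefixClosed-in-left a b k k<S closed)
... | inj₂ refl = a , b , ε , refl , refl , (λ i _ → refl)
... | inj₁ k<a with rotate-to-split a k k<a (prefixClosed-left a b k (<⇒≤ k<a) closed)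
...   | X , Y , path , sX , sXY , same-r =
  X , node Y b , (left* b path ◅◅ (rot X Y b ◅ ε)) , sX ,
  trans (sym (rotation-size X Y b)) (cong (λ z → suc (z + size b)) sXY) ,
  λ i ne → trans (rotation-r-stable X Y b i (λ e → ne (trans e (cong suc sX))))
                 (r-replace-left (node X Y) a b sXY i (λ _ → same-r i ne))

-- Induction on T = node A B: r_S ≤ r_T makes the labels 1..|A| closed in S, so S
-- rotates to node X Y with |X| = |A|, and then r_X ≤ r_A, r_Y ≤ r_B.
tamari-criterion : ∀ S T → size S ≡ size T → (∀ i → rB S i ≤ rB T i) → S ≤t T
tamari-criterion leaf leaf _ _ = ε
tamari-criterion S (node A B) same-size r≤ with rotate-to-split S (size A)
    (subst (suc (size A) ≤_) (sym same-size) (s≤s (m≤m+n (size A) (size B))))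
    (λ i 1≤i i≤A → ≤-trans (+-monoʳ-≤ i (≤-trans (r≤ i) (≤-reflexive (r-left A B i i≤A))))
                           (+-within i≤A (r-bounded A i)))
... | X , Y , path , sX , sXY , same-r =
  path ◅◅ (left* Y (tamari-criterion X A sX r≤-left) ◅◅ right* A (tamari-criterion Y B sY r≤-right))
  where
  sY : size Y ≡ size B
  sY = +-cancelˡ-≡ (size X) (size Y) (size B)
         (trans (suc-injective (trans sXY same-size)) (cong (_+ size B) (sym sX)))
  r≤-left : ∀ i → rB X i ≤ rB A i
  r≤-left i with i ≤? size X
  ... | no np = subst (_≤ rB A i) (sym (r-beyond X i (≰⇒> np))) z≤n
  ... | yes p = subst₂ _≤_ (trans (sym (same-r i not-root)) (r-left X Y i p)) (r-left A B i i≤A) (r≤ i)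
    where
    i≤A = subst (i ≤_) sX p
    not-root : i ≢ suc (size A)
    not-root e = 1+n≰n (subst (_≤ size A) e i≤A)
  r≤-right : ∀ i → rB Y i ≤ rB B i
  r≤-right zero    = subst (_≤ rB B 0) (sym (r-zero Y)) z≤n
  r≤-right (suc m) = subst₂ _≤_ (trans (sym (same-r _ not-root)) (r-right X Y _ m refl))
                                (r-right A B _ m shift) (r≤ _)
    where
    shift : suc (size X) + suc m ≡ suc (size A) + suc m
    shift = cong (λ z → suc z + suc m) sX
    not-root : suc (size X) + suc m ≢ suc (size A)
    not-root e = <-irrefl (sym (trans (sym shift) e)) (root<right (size A) m)

-- If r_T(i) < r_S(i), the label j = i + r_T(i) + 1 lies in the right subtree of
-- i in S, so compatibility gives l_T(j) < j - i = r_T(i) + 1, whereas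
-- l-after-right-subtree gives r_T(i) < l_T(j).
compatible⇒r≤ : ∀ S T → size S ≡ size T →
  (∀ i j → 1 ≤ i → i < j → j ≤ size S → j ∸ i ≤ rB S i → lB T j < j ∸ i) →
  ∀ i → rB S i ≤ rB T i
compatible⇒r≤ S T same-size compatible zero = subst (_≤ rB T 0) (sym (r-zero S)) z≤n
compatible⇒r≤ S T same-size compatible i@(suc _) with rB S i ≤? rB T i
... | yes p = p
... | no np = contradiction r<l (≤⇒≯ (s≤s⁻¹ l<1+r))
  where
  x = rB T i
  j = suc (i + x)
  gap : j ∸ i ≡ suc x
  gap = trans (cong (_∸ i) (sym (+-suc i x))) (m+n∸m≡n i (suc x))
  j≤S : j ≤ size S
  j≤S = ≤-trans (subst (_≤ i + rB S i) (+-suc i x) (+-monoʳ-≤ i (≰⇒> np)))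
                (right-subtree-within S i (≤-trans (s≤s z≤n) (≰⇒> np)))
  r<l : x < lB T j
  r<l = l-after-right-subtree T i (s≤s z≤n) (subst (i + x <_) same-size j≤S)
  l<1+r : lB T j < suc x
  l<1+r = subst (lB T j <_) gap
          (compatible i j (s≤s z≤n) (s≤s (m≤m+n i x)) j≤S (subst (_≤ rB S i) (sym gap) (≰⇒> np)))

-- Since (r_T, l_T) is compatible, l_T' ≤ l_T makes (r_T, l_T') compatible.
l-anti⇒r-mono : ∀ T T' → size T ≡ size T' → (∀ j → lB T' j ≤ lB T j) → ∀ i → rB T i ≤ rB T' i
l-anti⇒r-mono T T' same-size l≥ =
  compatible⇒r≤ T T' same-size (λ i j 1≤i i<j _ q → ≤-<-trans (l≥ j) (r-l-compatible T i j 1≤i i<j q))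

-- Every Tamari diagram is an r-word, every dual Tamari diagram an l-word

-- The conditions of a (dual) Tamari diagram of size n, for a word given as the
-- function i ↦ letter i.
IsTamariWord : ℕ → (ℕ → ℕ) → Set
IsTamariWord n f = (∀ i → 1 ≤ i → i ≤ n → f i ≤ n ∸ i) ×
                   (∀ i j → 1 ≤ i → i ≤ n → j ≤ f i → f (i + j) + j ≤ f i)

IsDualTamariWord : ℕ → (ℕ → ℕ) → Set
IsDualTamariWord n f = (∀ i → 1 ≤ i → i ≤ n → f i ≤ i ∸ 1) ×
                       (∀ i j → 1 ≤ i → i ≤ n → j ≤ f i → f (i ∸ j) + j ≤ f i)

-- A new first label whose right subtree is the first m old labels: walk down
-- the left spine to the subtree with m nodes and hang it to the right of the
-- new node.
prependNode : ℕ → BT → BT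
prependNode m leaf = node leaf leaf
prependNode m (node a b) with suc (size a + size b) ≤? m
... | yes _ = node leaf (node a b)
... | no _  = node (prependNode m a) b

prependNode-r : ∀ t m → m ≤ size t → PrefixClosed t m →
  size (prependNode m t) ≡ suc (size t) × rB (prependNode m t) 1 ≡ m ×
  (∀ i → 1 ≤ i → rB (prependNode m t) (suc i) ≡ rB t i)
prependNode-r leaf zero _ _ = refl , refl , λ { (suc i) _ → refl }
prependNode-r (node a b) m m≤t closed with suc (size a + size b) ≤? m
... | yes t≤m = refl , trans (r-root leaf (node a b) 1 refl) (≤-antisym t≤m m≤t) ,
                λ { (suc i) _ → r-right leaf (node a b) _ i refl }
... | no t≰m with prefixClosed-in-left a b m (≰⇒> t≰m) closed
...   | m≤a with prependNode-r a m m≤a (prefixClosed-left a b m m≤a closed)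
...     | sa' , ra'1 , ra'suc = cong (λ z → suc (z + size b)) sa' ,
                                trans (r-left a' b 1 (subst (1 ≤_) (sym sa') (s≤s z≤n))) ra'1 , shifted
  where
  a' = prependNode m a
  shifted : ∀ i → 1 ≤ i → rB (node a' b) (suc i) ≡ rB (node a b) i
  shifted i 1≤i with position (size a) i
  ... | inLeft i p = trans (r-left a' b (suc i) (subst (suc i ≤_) (sym sa') (s≤s p)))
                           (trans (ra'suc i 1≤i) (sym (r-left a b i p)))
  ... | atRoot     = trans (r-root a' b _ (cong suc (sym sa'))) (sym (r-root a b _ refl))
  ... | inRight k  = trans (r-right a' b _ k (cong (λ z → suc z + suc k) (sym sa'))) (sym (r-right a b _ k refl))

-- Build the tree for the letters 2..n, then prepend the first letter.
tree-with-r : ∀ n f → IsTamariWord n f → Σ BT λ S → size S ≡ n × (∀ i → 1 ≤ i → i ≤ n → rB S i ≡ f i)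
tree-with-r zero    f _ = leaf , refl , λ { .0 () z≤n }
tree-with-r (suc n) f (bounded , nested)
  with tree-with-r n (λ i → f (suc i)) ((λ i 1≤i i≤n → bounded (suc i) (s≤s z≤n) (s≤s i≤n)) ,
                                        (λ i j 1≤i i≤n j≤ → nested (suc i) j (s≤s z≤n) (s≤s i≤n) j≤))
... | S₀ , sS₀ , rS₀ = prependNode m S₀ , trans size-S (cong suc sS₀) , r-S
  where
  m = f 1
  m≤n : m ≤ n
  m≤n = bounded 1 (s≤s z≤n) (s≤s z≤n)
  closed : PrefixClosed S₀ m
  closed i 1≤i i≤m = subst (_≤ m) (trans (+-comm (f (suc i)) i) (cong (i +_) (sym (rS₀ i 1≤i (≤-trans i≤m m≤n)))))
                           (nested 1 i (s≤s z≤n) (s≤s z≤n) i≤m)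
  prepended = prependNode-r S₀ m (subst (m ≤_) (sym sS₀) m≤n) closed
  size-S = proj₁ prepended
  r-S : ∀ i → 1 ≤ i → i ≤ suc n → rB (prependNode m S₀) i ≡ f i
  r-S (suc zero)    _ _         = proj₁ (proj₂ prepended)
  r-S (suc (suc i)) _ (s≤s i≤n) = trans (proj₂ (proj₂ prepended) (suc i) (s≤s z≤n)) (rS₀ (suc i) (s≤s z≤n) i≤n)

-- The last m labels of B are closed under taking left subtrees.
SuffixClosed : BT → ℕ → Set
SuffixClosed B m = ∀ i → i ≤ size B → size B < i + m → lB B i + size B < i + m

suffixClosed-in-right : ∀ a b m → m < size (node a b) → SuffixClosed (node a b) m → m ≤ size b
suffixClosed-in-right a b m m<N closed with m ≤? size b
... | yes m≤b = m≤b
... | no m≰b = ⊥-elim (<⇒≱ m<N (+-cancelˡ-≤ (suc (size a)) _ _ root-closed))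
  where
  root-closed : suc (size a) + size (node a b) ≤ suc (size a) + m
  root-closed = subst (λ z → z + size (node a b) < suc (size a) + m) (l-root a b _ refl)
                      (closed (suc (size a)) (s≤s (m≤m+n (size a) (size b))) (s≤s (+-monoʳ-< (size a) (≰⇒> m≰b))))

suffixClosed-right : ∀ a b m → m ≤ size b → SuffixClosed (node a b) m → SuffixClosed b m
suffixClosed-right a b m m≤b closed zero    _   b<m = ⊥-elim (<⇒≱ b<m m≤b)
suffixClosed-right a b m m≤b closed (suc i) i≤b b<i+m =
  +-cancelˡ-< A _ _ (subst₂ _<_ (trans (cong (_+ N) (l-right a b _ i refl)) (shift (lB b (suc i))))
                                (+-assoc A (suc i) m) in-node)
  where
  A = suc (size a)
  N = size (node a b)
  shift : ∀ x → x + N ≡ A + (x + size b)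
  shift x = trans (+-suc x (size a + size b))
                  (cong suc (trans (sym (+-assoc x (size a) (size b)))
                                   (trans (cong (_+ size b) (+-comm x (size a))) (+-assoc (size a) x (size b)))))
  in-node : lB (node a b) (A + suc i) + N < A + suc i + m
  in-node = closed (A + suc i) (s≤s (+-monoʳ-≤ (size a) i≤b))
                   (subst (N <_) (sym (+-assoc A (suc i) m)) (s≤s (+-monoʳ-< (size a) b<i+m)))

-- A new last label whose left subtree is the last m old labels: walk down the
-- right spine to the subtree with m nodes and hang it to the left of the new node.
appendNode : ℕ → BT → BT
appendNode m leaf = node leaf leaf
appendNode m (node a b) with suc (size a + size b) ≤? m
... | yes _ = node (node a b) leaf
... | no _  = node a (appendNode m b)

appendNode-l : ∀ t m → m ≤ size t → SuffixClosed t m →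
  size (appendNode m t) ≡ suc (size t) × lB (appendNode m t) (suc (size t)) ≡ m ×
  (∀ i → i ≤ size t → lB (appendNode m t) i ≡ lB t i)
appendNode-l leaf zero _ _ = refl , refl , λ { zero _ → refl }
appendNode-l (node a b) m m≤t closed with suc (size a + size b) ≤? m
... | yes t≤m = cong suc (+-identityʳ _) , trans (l-root (node a b) leaf _ refl) (≤-antisym t≤m m≤t) ,
                λ i i≤t → l-left (node a b) leaf i i≤t
... | no t≰m with suffixClosed-in-right a b m (≰⇒> t≰m) closed
...   | m≤b with appendNode-l b m m≤b (suffixClosed-right a b m m≤b closed)
...     | sb' , lb'last , lb'same =
  cong suc (trans (cong (size a +_) sb') (+-suc (size a) (size b))) ,
  trans (l-right a b' _ (size b) (cong suc (sym (+-suc (size a) (size b))))) lb'last ,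
  unchanged
  where
  b' = appendNode m b
  unchanged : ∀ i → i ≤ size (node a b) → lB (node a b') i ≡ lB (node a b) i
  unchanged i i≤t with position (size a) i
  ... | inLeft i p = trans (l-left a b' i p) (sym (l-left a b i p))
  ... | atRoot     = trans (l-root a b' _ refl) (sym (l-root a b _ refl))
  ... | inRight k  = trans (l-right a b' _ k refl)
                           (trans (lb'same (suc k) (+-cancelˡ-≤ (size a) (suc k) (size b) (s≤s⁻¹ i≤t)))
                                  (sym (l-right a b _ k refl)))

-- Build the tree for the letters 1..n, then append the last letter.
tree-with-l : ∀ n f → IsDualTamariWord n f → Σ BT λ T → size T ≡ n × (∀ i → 1 ≤ i → i ≤ n → lB T i ≡ f i)
tree-with-l zero    f _ = leaf , refl , λ { .0 () z≤n }
tree-with-l (suc n) f (bounded , nested)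
  with tree-with-l n f ((λ i 1≤i i≤n → bounded i 1≤i (m≤n⇒m≤1+n i≤n)) ,
                        (λ i j 1≤i i≤n j≤ → nested i j 1≤i (m≤n⇒m≤1+n i≤n) j≤))
... | T₀ , refl , lT₀ = appendNode m T₀ , proj₁ appended , l-T
  where
  N = size T₀
  m = f (suc N)
  m≤N : m ≤ N
  m≤N = bounded (suc N) (s≤s z≤n) ≤-refl
  closed : SuffixClosed T₀ m
  closed zero    _   N<m = ⊥-elim (<⇒≱ N<m m≤N)
  closed (suc k) i≤N N<i+m = subst (λ z → z + N < i + m) (sym (lT₀ i (s≤s z≤n) i≤N))
                                   (subst (_≤ i + m) (+-suc (f i) N) within)
    where
    i = suc k
    i≤sN : i ≤ suc N
    i≤sN = m≤n⇒m≤1+n i≤N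
    gap : suc N ∸ i ≤ m
    gap = subst (suc N ∸ i ≤_) (m+n∸m≡n i m) (∸-monoˡ-≤ i N<i+m)
    nested-last : f i + (suc N ∸ i) ≤ m
    nested-last = subst (λ z → f z + (suc N ∸ i) ≤ m) (m∸[m∸n]≡n i≤sN) (nested (suc N) (suc N ∸ i) (s≤s z≤n) ≤-refl gap)
    within : f i + suc N ≤ i + m
    within = subst₂ _≤_ (trans (+-assoc (f i) (suc N ∸ i) i) (cong (f i +_) (m∸n+n≡m i≤sN))) (+-comm m i)
                        (+-monoˡ-≤ i nested-last)
  appended = appendNode-l T₀ m m≤N closed
  l-T : ∀ i → 1 ≤ i → i ≤ suc N → lB (appendNode m T₀) i ≡ f i
  l-T i 1≤i i≤sN with i ≤? N
  ... | yes i≤N = trans (proj₂ (proj₂ appended) i i≤N) (lT₀ i 1≤i i≤N)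
  ... | no i≰N  = subst (λ z → lB (appendNode m T₀) z ≡ f z) (sym (≤-antisym i≤sN (≰⇒> i≰N))) (proj₁ (proj₂ appended))

posPart negPart : ℤ → ℕ
posPart x = Int.∣ x Int.⊔ Int.+ 0 ∣
negPart x = Int.∣ x Int.⊓ Int.+ 0 ∣

OneZero : ℕ → ℕ → Set
OneZero a b = a ≡ 0 ⊎ b ≡ 0

module _ where
  open Int using (+_; -_; _-_)

  posPart-diff : ∀ a b → OneZero a b → posPart (+ a - + b) ≡ a
  posPart-diff .0 zero    (inj₁ refl) = refl
  posPart-diff .0 (suc b) (inj₁ refl) = refl
  posPart-diff a  .0      (inj₂ refl) = trans (cong (λ z → posPart (+ z)) (+-identityʳ a)) (⊔-identityʳ a)

  negPart-diff : ∀ a b → OneZero a b → negPart (+ a - + b) ≡ b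
  negPart-diff .0 zero    (inj₁ refl) = refl
  negPart-diff .0 (suc b) (inj₁ refl) = refl
  negPart-diff a  .0      (inj₂ refl) = trans (cong (λ z → negPart (+ z)) (+-identityʳ a)) (⊓-zeroʳ a)

  posPart-negPart : ∀ x → + posPart x - + negPart x ≡ x
  posPart-negPart (+ m)     = trans (cong₂ (λ u v → + u - + v) (⊔-identityʳ m) (⊓-zeroʳ m)) (cong +_ (+-identityʳ m))
  posPart-negPart Int.-[1+ m ] = refl

  diff-mono : ∀ {a b a' b'} → a ≤ a' → b' ≤ b → + a - + b Int.≤ + a' - + b'
  diff-mono a≤a' b'≤b = IntP.+-mono-≤ (Int.+≤+ a≤a') (IntP.neg-mono-≤ (Int.+≤+ b'≤b))

  posPart-mono : ∀ {x y} → x Int.≤ y → posPart x ≤ posPart y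
  posPart-mono (Int.-≤- _)   = z≤n
  posPart-mono Int.-≤+       = z≤n
  posPart-mono (Int.+≤+ m≤n) = ⊔-monoˡ-≤ 0 m≤n

  negPart-anti : ∀ {x y} → x Int.≤ y → negPart y ≤ negPart x
  negPart-anti (Int.-≤- n≤m)       = s≤s n≤m
  negPart-anti (Int.-≤+ {n = n})   = subst (_≤ _) (sym (⊓-zeroʳ n)) z≤n
  negPart-anti (Int.+≤+ {n = n} _) = subst (_≤ _) (sym (⊓-zeroʳ n)) z≤n

-- 0-indexed lookup with default 0.
nth : List ℤ → ℕ → ℤ
nth []       _       = Int.+ 0
nth (x ∷ xs) zero    = x
nth (x ∷ xs) (suc k) = nth xs k

at-uOf : ∀ c k → k < length c → at 0 (uOf c) (suc k) ≡ posPart (nth c k)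
at-uOf (x ∷ c) zero    _       = refl
at-uOf (x ∷ c) (suc k) (s≤s p) = at-uOf c k p

at-uOf-beyond : ∀ c k → length c ≤ k → at 0 (uOf c) (suc k) ≡ 0
at-uOf-beyond []      zero    _       = refl
at-uOf-beyond []      (suc k) _       = refl
at-uOf-beyond (x ∷ c) (suc k) (s≤s p) = at-uOf-beyond c k p

at-vOf : ∀ c k → k < length c → at 0 (vOf c) (suc (suc k)) ≡ negPart (nth c k)
at-vOf (x ∷ c) zero    _       = refl
at-vOf (x ∷ c) (suc k) (s≤s p) = at-vOf c k p

at-vOf-beyond : ∀ c k → length c ≤ k → at 0 (vOf c) (suc (suc k)) ≡ 0
at-vOf-beyond c k p = at-beyond 0 (map negPart c) (suc k) (s≤s (subst (_≤ k) (sym (length-map negPart c)) p))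

nth-applyUpTo : ∀ (f : ℕ → ℤ) (m k : ℕ) → k < m → nth (applyUpTo f m) k ≡ f k
nth-applyUpTo f (suc m) zero    _       = refl
nth-applyUpTo f (suc m) (suc k) (s≤s p) = nth-applyUpTo (λ x → f (suc x)) m k p

applyUpTo-nth : ∀ (f : ℕ → ℤ) (c : List ℤ) (m : ℕ) → length c ≡ m → (∀ k → k < m → f k ≡ nth c k) → applyUpTo f m ≡ c
applyUpTo-nth f []      zero    _ _    = refl
applyUpTo-nth f (x ∷ c) (suc m) e same =
  cong₂ _∷_ (same 0 (s≤s z≤n)) (applyUpTo-nth (λ k → f (suc k)) c m (suc-injective e) (λ k p → same (suc k) (s≤s p)))

pointwise-applyUpTo⁺ : {A B : Set} {R : A → B → Set} (f : ℕ → A) (g : ℕ → B) (m : ℕ) →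
  (∀ k → k < m → R (f k) (g k)) → Pointwise R (applyUpTo f m) (applyUpTo g m)
pointwise-applyUpTo⁺ f g zero    _   = []
pointwise-applyUpTo⁺ f g (suc m) rel =
  rel 0 (s≤s z≤n) ∷ pointwise-applyUpTo⁺ (λ k → f (suc k)) (λ k → g (suc k)) m (λ k p → rel (suc k) (s≤s p))

uOf-mono : ∀ {c c'} → Pointwise Int._≤_ c c' → ∀ i → at 0 (uOf c) i ≤ at 0 (uOf c') i
uOf-mono []         i             = ≤-refl
uOf-mono (_ ∷ _)    zero          = ≤-refl
uOf-mono (x≤y ∷ _)  (suc zero)    = posPart-mono x≤y
uOf-mono (_ ∷ rest) (suc (suc i)) = uOf-mono rest (suc i)

map-negPart-anti : ∀ {c c'} → Pointwise Int._≤_ c c' → ∀ i → at 0 (map negPart c') i ≤ at 0 (map negPart c) i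
map-negPart-anti []         i             = ≤-refl
map-negPart-anti (_ ∷ _)    zero          = ≤-refl
map-negPart-anti (x≤y ∷ _)  (suc zero)    = negPart-anti x≤y
map-negPart-anti (_ ∷ rest) (suc (suc i)) = map-negPart-anti rest (suc i)

vOf-anti : ∀ {c c'} → Pointwise Int._≤_ c c' → ∀ i → at 0 (vOf c') i ≤ at 0 (vOf c) i
vOf-anti c≤c' zero          = ≤-refl
vOf-anti c≤c' (suc zero)    = ≤-refl
vOf-anti c≤c' (suc (suc i)) = map-negPart-anti c≤c' (suc i)

-- ψ of an interval is the pair of words (r_S, l_T)

-- In an interval [S,T], r_S(i) and l_T(i+1) are never both positive: if
-- r_S(i) > 0 then r_T(i) > 0, so i+1 lies in the right subtree of i in T,
-- which leaves no room for a left subtree of i+1.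
interval-one-zero : ∀ {S T} → S ≤t T → ∀ i → 1 ≤ i → OneZero (rB S i) (lB T (suc i))
interval-one-zero {S} {T} S≤T i 1≤i with rB S i in r-eq
... | zero  = inj₁ refl
... | suc _ = inj₂ (n<1⇒n≡0 (subst (lB T (suc i) <_) gap
                     (r-l-compatible T i (suc i) 1≤i ≤-refl (subst (_≤ rB T i) (sym gap) 1≤rT))))
  where
  gap : suc i ∸ i ≡ 1
  gap = trans (cong (_∸ i) (+-comm 1 i)) (m+n∸m≡n i 1)
  1≤rT : 1 ≤ rB T i
  1≤rT = ≤-trans (subst (1 ≤_) (sym r-eq) (s≤s z≤n)) (≤t-r-mono S≤T i)

-- The letter i of ψ, i.e. r_S(i) - l_T(i+1), indexed from 0.
ψ-letter : BT → BT → ℕ → ℤ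
ψ-letter S T k = Int.+ rB S (suc k) Int.- Int.+ lB T (suc (suc k))

module _ (n' : ℕ) where
  private
    n = suc n'

  length-ψ : ∀ S T → length (ψ n S T) ≡ n'
  length-ψ S T = length-applyUpTo (ψ-letter S T) n'

  ψ-posParts : ∀ {S T} → IsTI n S T → ∀ i → at 0 (uOf (ψ n S T)) i ≡ rB S i
  ψ-posParts {S} {T} I zero = trans (at-zero 0 (uOf (ψ n S T))) (sym (r-zero S))
  ψ-posParts {S} {T} (sS , _ , S≤T) (suc k) with k <? n'
  ... | yes k<n' = begin
    at 0 (uOf (ψ n S T)) (suc k)  ≡⟨ at-uOf (ψ n S T) k (subst (k <_) (sym (length-ψ S T)) k<n') ⟩
    posPart (nth (ψ n S T) k)     ≡⟨ cong posPart (nth-applyUpTo (ψ-letter S T) n' k k<n') ⟩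
    posPart (ψ-letter S T k)      ≡⟨ posPart-diff _ _ (interval-one-zero S≤T (suc k) (s≤s z≤n)) ⟩
    rB S (suc k)                  ∎
    where open ≡-Reasoning
  ... | no k≮n' = trans (at-uOf-beyond (ψ n S T) k (subst (_≤ k) (sym (length-ψ S T)) (≮⇒≥ k≮n')))
                        (sym (r-from-last S (suc k) (subst (_≤ suc k) (sym sS) (s≤s (≮⇒≥ k≮n')))))

  ψ-negParts : ∀ {S T} → IsTI n S T → ∀ i → at 0 (vOf (ψ n S T)) i ≡ lB T i
  ψ-negParts {S} {T} I zero       = sym (l-zero T)
  ψ-negParts {S} {T} I (suc zero) = sym (n≤0⇒n≡0 (l-bounded T 1))
  ψ-negParts {S} {T} (_ , sT , S≤T) (suc (suc k)) with k <? n'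
  ... | yes k<n' = begin
    at 0 (vOf (ψ n S T)) (suc (suc k))  ≡⟨ at-vOf (ψ n S T) k (subst (k <_) (sym (length-ψ S T)) k<n') ⟩
    negPart (nth (ψ n S T) k)           ≡⟨ cong negPart (nth-applyUpTo (ψ-letter S T) n' k k<n') ⟩
    negPart (ψ-letter S T k)            ≡⟨ negPart-diff _ _ (interval-one-zero S≤T (suc k) (s≤s z≤n)) ⟩
    lB T (suc (suc k))                  ∎
    where open ≡-Reasoning
  ... | no k≮n' = trans (at-vOf-beyond (ψ n S T) k (subst (_≤ k) (sym (length-ψ S T)) (≮⇒≥ k≮n')))
                        (sym (l-beyond T _ (subst (_< suc (suc k)) (sym sT) (s≤s (s≤s (≮⇒≥ k≮n'))))))

r-isTamariWord : ∀ B → IsTamariWord (size B) (rB B)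
r-isTamariWord B = (λ i _ _ → r-bounded B i) , (λ i j _ _ → r-nested B i j)

l-isDualTamariWord : ∀ B → IsDualTamariWord (size B) (lB B)
l-isDualTamariWord B = (λ i _ _ → l-bounded B i) , (λ i j _ _ → l-nested B i j)

isTamariWord-resp : ∀ {n f g} → (∀ i → f i ≡ g i) → IsTamariWord n f → IsTamariWord n g
isTamariWord-resp {n} f≡g (bounded , nested) =
  (λ i 1≤i i≤n → subst (_≤ n ∸ i) (f≡g i) (bounded i 1≤i i≤n)) ,
  (λ i j 1≤i i≤n j≤ → subst₂ (λ u v → u + j ≤ v) (f≡g (i + j)) (f≡g i)
                              (nested i j 1≤i i≤n (subst (j ≤_) (sym (f≡g i)) j≤)))

isDualTamariWord-resp : ∀ {n f g} → (∀ i → f i ≡ g i) → IsDualTamariWord n f → IsDualTamariWord n g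
isDualTamariWord-resp f≡g (bounded , nested) =
  (λ i 1≤i i≤n → subst (_≤ i ∸ 1) (f≡g i) (bounded i 1≤i i≤n)) ,
  (λ i j 1≤i i≤n j≤ → subst₂ (λ u v → u + j ≤ v) (f≡g (i ∸ j)) (f≡g i)
                              (nested i j 1≤i i≤n (subst (j ≤_) (sym (f≡g i)) j≤)))

-- For an interval [S,T], the pair (r_S, l_T) is compatible, since r_S ≤ r_T.
interval-compatible : ∀ {S T} → S ≤t T → ∀ i j → 1 ≤ i → i < j → j ∸ i ≤ rB S i → lB T j < j ∸ i
interval-compatible {S} {T} S≤T i j 1≤i i<j q = r-l-compatible T i j 1≤i i<j (≤-trans q (≤t-r-mono S≤T i))

length-uOf : ∀ c → length (uOf c) ≡ suc (length c)
length-uOf c = trans (length-++ (map posPart c)) (trans (+-comm _ 1) (cong suc (length-map posPart c)))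

length-vOf : ∀ c → length (vOf c) ≡ suc (length c)
length-vOf c = cong suc (length-map negPart c)

module _ (n' : ℕ) where
  private
    n = suc n'

  ψ-cubic : ∀ S T → IsTI n S T → IsCC n (ψ n S T)
  ψ-cubic S T I@(sS , sT , S≤T) =
    length-ψ n' S T ,
    (trans (length-uOf c) (cong suc (length-ψ n' S T)) ,
     isTamariWord-resp (λ i → sym (ψ-posParts n' I i)) (subst (λ m → IsTamariWord m (rB S)) sS (r-isTamariWord S))) ,
    (trans (length-vOf c) (cong suc (length-ψ n' S T)) ,
     isDualTamariWord-resp (λ i → sym (ψ-negParts n' I i)) (subst (λ m → IsDualTamariWord m (lB T)) sT (l-isDualTamariWord T))) ,
    λ i j 1≤i i<j _ q → subst (_< j ∸ i) (sym (ψ-negParts n' I j))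
                              (interval-compatible S≤T i j 1≤i i<j (subst (j ∸ i ≤_) (ψ-posParts n' I i) q))
    where
    c = ψ n S T

  -- ψ determines r_S and l_T; l_T determines r_T; r-words determine trees.
  ψ-injective : ∀ S T S' T' → IsTI n S T → IsTI n S' T' → ψ n S T ≡ ψ n S' T' → S ≡ S' × T ≡ T'
  ψ-injective S T S' T' I I' same-ψ =
    r-injective S S' (trans (proj₁ I) (sym (proj₁ I'))) same-rS ,
    r-injective T T' sT≡sT' (λ i → ≤-antisym (l-anti⇒r-mono T T' sT≡sT' (λ j → ≤-reflexive (sym (same-lT j))) i)
                                             (l-anti⇒r-mono T' T (sym sT≡sT') (λ j → ≤-reflexive (same-lT j)) i))
    where
    sT≡sT' = trans (proj₁ (proj₂ I)) (sym (proj₁ (proj₂ I')))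
    same-rS : ∀ i → rB S i ≡ rB S' i
    same-rS i = trans (sym (ψ-posParts n' I i)) (trans (cong (λ c → at 0 (uOf c) i) same-ψ) (ψ-posParts n' I' i))
    same-lT : ∀ i → lB T i ≡ lB T' i
    same-lT i = trans (sym (ψ-negParts n' I i)) (trans (cong (λ c → at 0 (vOf c) i) same-ψ) (ψ-negParts n' I' i))

  -- The trees with r-word u and l-word v form an interval, by compatibility,
  -- and ψ gives back c since posPart x - negPart x = x.
  ψ-surjective : ∀ c → IsCC n c → Σ BT λ S → Σ BT λ T → IsTI n S T × ψ n S T ≡ c
  ψ-surjective c (length-c , (_ , u-word) , (_ , v-word) , compatible)
    with tree-with-r n (at 0 (uOf c)) u-word | tree-with-l n (at 0 (vOf c)) v-word
  ... | S , sS , rS | T , sT , lT = S , T , (sS , sT , S≤T) , applyUpTo-nth (ψ-letter S T) c n' length-c letters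
    where
    S≤T : S ≤t T
    S≤T = tamari-criterion S T (trans sS (sym sT)) (compatible⇒r≤ S T (trans sS (sym sT))
      λ i j 1≤i i<j j≤S q → subst (_< j ∸ i) (sym (lT j (≤-trans (s≤s z≤n) i<j) (subst (j ≤_) sS j≤S)))
        (compatible i j 1≤i i<j (subst (j ≤_) sS j≤S) (subst (j ∸ i ≤_) (rS i 1≤i (≤-trans (<⇒≤ i<j) (subst (j ≤_) sS j≤S))) q)))
    letters : ∀ k → k < n' → ψ-letter S T k ≡ nth c k
    letters k k<n' = begin
      Int.+ rB S (suc k) Int.- Int.+ lB T (suc (suc k))
        ≡⟨ cong₂ (λ u v → Int.+ u Int.- Int.+ v)
                 (trans (rS (suc k) (s≤s z≤n) (s≤s (<⇒≤ k<n'))) (at-uOf c k k<c))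
                 (trans (lT (suc (suc k)) (s≤s z≤n) (s≤s k<n')) (at-vOf c k k<c)) ⟩
      Int.+ posPart (nth c k) Int.- Int.+ negPart (nth c k)
        ≡⟨ posPart-negPart (nth c k) ⟩
      nth c k ∎
      where
      open ≡-Reasoning
      k<c = subst (k <_) (sym length-c) k<n'

  -- Rotations move r up and l down, so ψ up; conversely ψ ≤ ψ' compares the
  -- r-words of S, S' and the l-words (hence the r-words) of T, T'.
  ψ-order : ∀ S T S' T' → IsTI n S T → IsTI n S' T' → ((S , T) ≤ti (S' , T') ⇔ (ψ n S T ≤cc ψ n S' T'))
  ψ-order S T S' T' I I' = mk⇔ to from
    where
    to : (S , T) ≤ti (S' , T') → ψ n S T ≤cc ψ n S' T'
    to (S≤S' , T≤T') = pointwise-applyUpTo⁺ (ψ-letter S T) (ψ-letter S' T') n'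
      (λ k _ → diff-mono (≤t-r-mono S≤S' (suc k)) (≤t-l-anti T≤T' (suc (suc k))))
    from : ψ n S T ≤cc ψ n S' T' → (S , T) ≤ti (S' , T')
    from ψ≤ψ' =
      tamari-criterion S S' (trans (proj₁ I) (sym (proj₁ I')))
        (λ i → subst₂ _≤_ (ψ-posParts n' I i) (ψ-posParts n' I' i) (uOf-mono ψ≤ψ' i)) ,
      tamari-criterion T T' sT≡sT' (l-anti⇒r-mono T T' sT≡sT'
        (λ j → subst₂ _≤_ (ψ-negParts n' I' j) (ψ-negParts n' I j) (vOf-anti ψ≤ψ' j)))
      where
      sT≡sT' = trans (proj₁ (proj₂ I)) (sym (proj₁ (proj₂ I')))

mainTheorem1 : (n : ℕ) → 1 ≤ n →
    ((S T : BT) → IsTI n S T → IsCC n (ψ n S T)) ×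
    ((S T S' T' : BT) → IsTI n S T → IsTI n S' T' →
       ψ n S T ≡ ψ n S' T' → (S ≡ S' × T ≡ T')) ×
    ((c : List ℤ) → IsCC n c →
       Σ BT (λ S → Σ BT (λ T → IsTI n S T × ψ n S T ≡ c))) ×
    ((S T S' T' : BT) → IsTI n S T → IsTI n S' T' →
       ((S , T) ≤ti (S' , T') ⇔ (ψ n S T ≤cc ψ n S' T')))
mainTheorem1 (suc n') _ = ψ-cubic n' , ψ-injective n' , ψ-surjective n' , ψ-order n'
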